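{- (Intuitionistically valid.) If there is a map $f:\mathbb{R}\to\mathbb{R}$ that has a jump at some point, then $x=y$ or $x\neq y$ for all $x,y\in\mathbb{R}$.
   Context: The statement is a theorem of intuitionistic higher-order logic, and $\mathbb{R}$ denotes the Dedekind reals. A map $f:\mathbb{R}\to\mathbb{R}$ jumps at $x$ if there is $\epsilon>0$ such that $|f(y)-f(x)|>\epsilon$ for all $y>x$. -}

module Defs where

open import Level using (0ℓ)
open import Data.Rational using (ℚ; 0ℚ; _+_; _-_; -_) renaming (_<_ to _<ℚ_)
open import Data.Product using (Σ; ∃; _×_; _,_)
open import Data.Sum using (_⊎_)
open import Relation.Nullary using (¬_)

_⇔_ : Set → Set → Set
A ⇔ B = (A → B) × (B → A)

-- A "cut": a pair of predicates on ℚ (lower and upper part), with no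
-- conditions.  Used only to describe the cuts produced by the standard
-- formulas for -, |_| and the order.
record Cut : Set₁ where
  field
    L : ℚ → Set
    U : ℚ → Set

record ℝ : Set₁ where
  field
    L : ℚ → Set
    U : ℚ → Set
    inhabitedL : ∃ λ q → L q
    inhabitedU : ∃ λ q → U q
    roundedL   : ∀ q → L q ⇔ (∃ λ r → (q <ℚ r) × L r)
    roundedU   : ∀ q → U q ⇔ (∃ λ r → (r <ℚ q) × U r)
    disjoint   : ∀ q → ¬ (L q × U q)
    located    : ∀ q r → q <ℚ r → L q ⊎ U r

open ℝ public

cut : ℝ → Cut
cut x = record { L = L x ; U = U x }

ιᶜ : ℚ → Cut
ιᶜ q = record { L = λ p → p <ℚ q ; U = λ p → q <ℚ p }

_-ᶜ_ : Cut → Cut → Cut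
a -ᶜ b = record
  { L = λ q → ∃ λ r → ∃ λ s → Cut.L a r × Cut.U b s × (q <ℚ (r - s))
  ; U = λ q → ∃ λ r → ∃ λ s → Cut.U a r × Cut.L b s × ((r - s) <ℚ q)
  }

-- Absolute value |a| = max(a, -a): lower cut is the union, upper cut the
-- intersection of those of a and -a (where L(-a) = {q | -q ∈ U a}).
∣_∣ᶜ : Cut → Cut
∣ a ∣ᶜ = record
  { L = λ q → Cut.L a q ⊎ Cut.U a (- q)
  ; U = λ q → Cut.U a q × Cut.L a (- q)
  }

_<ᶜ_ : Cut → Cut → Set
a <ᶜ b = ∃ λ q → Cut.U a q × Cut.L b q

_<ℝ_ : ℝ → ℝ → Set
x <ℝ y = cut x <ᶜ cut y

_≃_ : ℝ → ℝ → Set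
x ≃ y = (∀ q → L x q ⇔ L y q) × (∀ q → U x q ⇔ U y q)

_≄_ : ℝ → ℝ → Set
x ≄ y = ¬ (x ≃ y)

-- Maps ℝ → ℝ (in the internal logic every map respects equality).
Extensional : (ℝ → ℝ) → Set₁
Extensional f = ∀ x y → x ≃ y → f x ≃ f y

JumpsAt : (ℝ → ℝ) → ℝ → Set₁
JumpsAt f x = Σ ℝ λ ε → (ιᶜ 0ℚ <ᶜ cut ε) ×
  (∀ y → x <ℝ y → cut ε <ᶜ ∣ cut (f y) -ᶜ cut (f x) ∣ᶜ)

-- Let f jump at x by more than a rational e > 0.  For any y, locating f y against
-- an e/2-approximation of f x shows that f y and f x are either e-close, which the
-- jump forbids when x < y, or apart, which extensionality forbids when y = x.  So
-- ¬ (x < y) ∨ y ≠ x for every y.  The real y = max (x , x + (b - a)) equals x when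
-- ¬ (a < b) and exceeds x when a < b, which yields ¬ (a < b) ∨ ¬ ¬ (a < b).  Deciding
-- both a < b and b < a in this weak sense decides a = b, because ¬ (a < b) and
-- ¬ (b < a) together give a = b.

module Submission where

open import Defs
open import Data.Product using (Σ; _×_)
open import Data.Sum using (_⊎_)
open import Data.Empty using (⊥-elim)
open import Data.Integer as ℤ using (-[1+_])
import Data.Integer.Properties as ℤ
open import Data.Nat using (ℕ; zero; suc)
import Data.Nat.Properties as ℕ
open import Data.Product using (∃; ∃₂; _,_; proj₁; proj₂) renaming (swap to ×-swap)
open import Data.Sum using (inj₁; inj₂; [_,_]′; swap)
open import Data.Rational
  using (ℚ; mkℚ; 0ℚ; 1ℚ; ½; _+_; _-_; -_; _*_; 1/_; _⊔_; _<_; _≤_; *<*; Positive; NonZero; positive)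
open import Data.Rational.Literals using (fromℤ)
open import Data.Rational.Properties
  using ( _≟_; _<?_; +-*-commutativeRing; toℚᵘ-injective; toℚᵘ-homo-+; pos⇒nonZero
        ; <-irrefl; <-trans; <-≤-trans; <-dense; <-cmp; ≮⇒≥; neg-antimono-<
        ; +-assoc; +-identityˡ; +-identityʳ; +-inverseʳ; +-monoˡ-<; +-monoʳ-<; +-mono-<; +-monoˡ-≤
        ; *-assoc; *-identityʳ; *-zeroˡ; *-inverseˡ; *-monoˡ-<-pos
        ; ⊔-sel; p≤p⊔q; p≤q⊔p; module ≤-Reasoning )
import Data.Rational.Unnormalised as ℚᵘ
import Data.Rational.Unnormalised.Properties as ℚᵘ
open import Function using (_∘_; id)
open import Relation.Binary.PropositionalEquality using (_≡_; refl; sym; trans; cong; subst)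
open import Relation.Binary.Definitions using (tri<; tri≈; tri>)
open import Relation.Nullary using (¬_; yes; no)
open import Relation.Nullary.Decidable.Core using (dec⇒maybe)
open import Tactic.RingSolver using (solve-∀)
open import Tactic.RingSolver.Core.AlmostCommutativeRing
  using (AlmostCommutativeRing; fromCommutativeRing)

open ≤-Reasoning

private variable
  p q r s : ℚ

ℚ-ring : AlmostCommutativeRing _ _
ℚ-ring = fromCommutativeRing +-*-commutativeRing (λ p → dec⇒maybe (0ℚ ≟ p))

neg-involutive : ∀ p → - (- p) ≡ p
neg-involutive = solve-∀ ℚ-ring

half+half : ∀ p → p * ½ + p * ½ ≡ p
half+half = solve-∀ ℚ-ring

half-pos : 0ℚ < p → 0ℚ < p * ½
half-pos {p} 0<p = subst (_< p * ½) (*-zeroˡ ½) (*-monoˡ-<-pos ½ 0<p)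

p<p+q : 0ℚ < q → p < p + q
p<p+q {q} {p} 0<q = subst (_< p + q) (+-identityʳ p) (+-monoʳ-< p 0<q)

half< : 0ℚ < p → p * ½ < p
half< {p} 0<p = subst (p * ½ <_) (half+half p) (p<p+q (half-pos 0<p))

p-q<p : 0ℚ < q → p - q < p
p-q<p {q} {p} 0<q = begin-strict
  p - q         <⟨ p<p+q 0<q ⟩
  p - q + q     ≡⟨ cancel p q ⟩
  p             ∎
  where
  cancel : ∀ p q → p - q + q ≡ p
  cancel = solve-∀ ℚ-ring

p<q⇒0<q-p : p < q → 0ℚ < q - p
p<q⇒0<q-p {p} {q} p<q = subst (_< q - p) (+-inverseʳ p) (+-monoˡ-< (- p) p<q)

p<p+q⇒0<q : p < p + q → 0ℚ < q
p<p+q⇒0<q {p} {q} p<p+q = subst (0ℚ <_) (cancel p q) (p<q⇒0<q-p p<p+q)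
  where
  cancel : ∀ p q → p + q - p ≡ q
  cancel = solve-∀ ℚ-ring

0<p+q⇒-q<p : 0ℚ < p + q → - q < p
0<p+q⇒-q<p {p} {q} 0<p+q = begin-strict
  - q           ≡⟨ sym (+-identityˡ (- q)) ⟩
  0ℚ - q        <⟨ +-monoˡ-< (- q) 0<p+q ⟩
  p + q - q     ≡⟨ cancel p q ⟩
  p             ∎
  where
  cancel : ∀ p q → p + q - q ≡ p
  cancel = solve-∀ ℚ-ring

p<q-r⇒r+p<q : p < q - r → r + p < q
p<q-r⇒r+p<q {p} {q} {r} p<q-r = begin-strict
  r + p         <⟨ +-monoʳ-< r p<q-r ⟩
  r + (q - r)   ≡⟨ cancel q r ⟩
  q             ∎
  where
  cancel : ∀ q r → r + (q - r) ≡ q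
  cancel = solve-∀ ℚ-ring

p-q<-r⇒p+r<q : p - q < - r → p + r < q
p-q<-r⇒p+r<q {p} {q} {r} p-q<-r = begin-strict
  p + r               ≡⟨ cancelˡ p q r ⟩
  p - q + (q + r)     <⟨ +-monoˡ-< (q + r) p-q<-r ⟩
  - r + (q + r)       ≡⟨ cancelʳ q r ⟩
  q                   ∎
  where
  cancelˡ : ∀ p q r → p + r ≡ p - q + (q + r)
  cancelˡ = solve-∀ ℚ-ring
  cancelʳ : ∀ q r → - r + (q + r) ≡ q
  cancelʳ = solve-∀ ℚ-ring

fromℕ : ℕ → ℚ
fromℕ n = fromℤ (ℤ.+ n)

fromℕ-suc : ∀ n → fromℕ (suc n) ≡ 1ℚ + fromℕ n
fromℕ-suc n = toℚᵘ-injective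
  (ℚᵘ.≃-trans (ℚᵘ.*≡* numerators) (ℚᵘ.≃-sym (toℚᵘ-homo-+ 1ℚ (fromℕ n))))
  where
  numerators : ℤ.+ suc n ℤ.* ℤ.+ 1 ≡ (ℤ.+ 1 ℤ.+ ℤ.+ n ℤ.* ℤ.+ 1) ℤ.* ℤ.+ 1
  numerators = cong (λ m → (ℤ.+ 1 ℤ.+ m) ℤ.* ℤ.+ 1) (sym (ℤ.*-identityʳ (ℤ.+ n)))

<-fromℕ : ∀ q → ∃ λ n → q < fromℕ n
<-fromℕ (mkℚ (ℤ.+ k) d-1 _) = suc k , *<* (subst (ℤ._< ℤ.+ suc k ℤ.* ℤ.+ suc d-1)
  (sym (ℤ.*-identityʳ (ℤ.+ k))) (ℤ.+<+ (ℕ.m≤m*n (suc k) (suc d-1))))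
<-fromℕ (mkℚ -[1+ k ] d-1 _) = 1 , *<* (subst (ℤ._< ℤ.+ 1 ℤ.* ℤ.+ suc d-1)
  (sym (ℤ.*-identityʳ -[1+ k ])) ℤ.-<+)

archimedean : 0ℚ < r → ∀ p q → ∃ λ n → q < p + fromℕ n * r
archimedean {r} 0<r p q =
  let (n , [q-p]/r<n) = <-fromℕ ((q - p) * 1/ r)
  in n , (begin-strict
    q                          ≡⟨ cancel p q ⟩
    p + (q - p)                ≡⟨ cong (p +_) (sym (*-inverse-cancel (q - p))) ⟩
    p + (q - p) * 1/ r * r     <⟨ +-monoʳ-< p (*-monoˡ-<-pos r [q-p]/r<n) ⟩
    p + fromℕ n * r            ∎)
  where
  instance
    r-positive : Positive r
    r-positive = positive 0<r
    r-nonZero : NonZero r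
    r-nonZero = pos⇒nonZero r
  cancel : ∀ p q → q ≡ p + (q - p)
  cancel = solve-∀ ℚ-ring
  *-inverse-cancel : ∀ s → s * 1/ r * r ≡ s
  *-inverse-cancel s = trans (*-assoc s (1/ r) r) (trans (cong (s *_) (*-inverseˡ r)) (*-identityʳ s))

module _ (x : ℝ) where

  L-round : L x q → ∃ λ r → q < r × L x r
  L-round {q} = proj₁ (roundedL x q)

  U-round : U x q → ∃ λ r → r < q × U x r
  U-round {q} = proj₁ (roundedU x q)

  L-down : L x r → q < r → L x q
  L-down {r} {q} Lr q<r = proj₂ (roundedL x q) (r , q<r , Lr)

  U-up : U x q → q < r → U x r
  U-up {q} {r} Uq q<r = proj₂ (roundedU x r) (q , q<r , Uq)

  U-up-≤ : U x q → q ≤ r → U x r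
  U-up-≤ Uq q≤r = let (q′ , q′<q , Uq′) = U-round Uq in U-up Uq′ (<-≤-trans q′<q q≤r)

  L<U : L x q → U x r → q < r
  L<U {q} {r} Lq Ur with <-cmp q r
  ... | tri< q<r _ _ = q<r
  ... | tri≈ _ refl _ = ⊥-elim (disjoint x q (Lq , Ur))
  ... | tri> _ _ r<q = ⊥-elim (disjoint x r (L-down Lq r<q , Ur))

  grid-bracket : 0ℚ < r → ∀ n → L x p → U x (p + fromℕ n * r) → ∃ λ u → L x u × U x (u + r + r)
  grid-bracket {r} {p} _ zero Lp Up =
    ⊥-elim (disjoint x p (Lp , subst (U x) (trans (cong (p +_) (*-zeroˡ r)) (+-identityʳ p)) Up))
  grid-bracket {r} {p} 0<r (suc n) Lp Up with located x (p + r) (p + r + r) (p<p+q 0<r)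
  ... | inj₂ U[p+2r] = p , Lp , U[p+2r]
  ... | inj₁ L[p+r] = grid-bracket 0<r n L[p+r] (subst (U x) step Up)
    where
    shift : ∀ p r m → p + (1ℚ + m) * r ≡ p + r + m * r
    shift = solve-∀ ℚ-ring
    step : p + fromℕ (suc n) * r ≡ p + r + fromℕ n * r
    step = trans (cong (λ m → p + m * r) (fromℕ-suc n)) (shift p r (fromℕ n))

  approximate : 0ℚ < r → ∃₂ λ u v → L x u × U x v × v < u + r
  approximate {r} 0<r =
    let (lo , Llo) = inhabitedL x
        (hi , Uhi) = inhabitedU x
        (n , hi<lo+nh) = archimedean 0<h lo hi
        (u , Lu , U[u+2h]) = grid-bracket 0<h n Llo (U-up Uhi hi<lo+nh)
    in u , u + h + h , Lu , U[u+2h] , width u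
    where
    h : ℚ
    h = r * ½ * ½
    0<h : 0ℚ < h
    0<h = half-pos (half-pos 0<r)
    width : ∀ u → u + h + h < u + r
    width u = begin-strict
      u + h + h       ≡⟨ +-assoc u h h ⟩
      u + (h + h)     ≡⟨ cong (u +_) (half+half (r * ½)) ⟩
      u + r * ½       <⟨ +-monoʳ-< u (half< 0<r) ⟩
      u + r           ∎

infix  28 -ℝ_
infixl 27 _+ℝ_ _-ℝ_
infixl 26 _⊔ℝ_

-ℝ_ : ℝ → ℝ
-ℝ a = record
  { L = λ q → U a (- q)
  ; U = λ q → L a (- q)
  ; inhabitedL = let (r , Ur) = inhabitedU a in - r , U-neg Ur
  ; inhabitedU = let (r , Lr) = inhabitedL a in - r , L-neg Lr
  ; roundedL = λ q → (λ Ua-q → let (r , r<-q , Ur) = U-round a Ua-q in - r , <-neg r<-q , U-neg Ur)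
                   , (λ (r , q<r , Ua-r) → U-up a Ua-r (neg-antimono-< q<r))
  ; roundedU = λ q → (λ La-q → let (r , -q<r , Lr) = L-round a La-q in - r , neg-< -q<r , L-neg Lr)
                   , (λ (r , r<q , La-r) → L-down a La-r (neg-antimono-< r<q))
  ; disjoint = λ q (Ua-q , La-q) → disjoint a (- q) (La-q , Ua-q)
  ; located = λ q r q<r → swap (located a (- r) (- q) (neg-antimono-< q<r))
  }
  where
  U-neg : U a r → U a (- - r)
  U-neg {r} = subst (U a) (sym (neg-involutive r))
  L-neg : L a r → L a (- - r)
  L-neg {r} = subst (L a) (sym (neg-involutive r))
  <-neg : r < - q → q < - r
  <-neg {r} {q} r<-q = subst (_< - r) (neg-involutive q) (neg-antimono-< r<-q)
  neg-< : - q < r → - r < q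
  neg-< {q} {r} -q<r = subst (- r <_) (neg-involutive q) (neg-antimono-< -q<r)

_+ℝ_ : ℝ → ℝ → ℝ
a +ℝ b = record
  { L = L+
  ; U = U+
  ; inhabitedL = let (r , Lr) = inhabitedL a ; (s , Ls) = inhabitedL b in r + s , raise Lr Ls
  ; inhabitedU = let (r , Ur) = inhabitedU a ; (s , Us) = inhabitedU b in r + s , lower Ur Us
  ; roundedL = λ q → (λ (r , s , Lr , Ls , q<r+s) → r + s , q<r+s , raise Lr Ls)
                   , (λ (t , q<t , r , s , Lr , Ls , t<r+s) → r , s , Lr , Ls , <-trans q<t t<r+s)
  ; roundedU = λ q → (λ (r , s , Ur , Us , r+s<q) → r + s , r+s<q , lower Ur Us)
                   , (λ (t , t<q , r , s , Ur , Us , r+s<t) → r , s , Ur , Us , <-trans r+s<t t<q)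
  ; disjoint = λ q ((r , s , Lr , Ls , q<r+s) , (r′ , s′ , Ur′ , Us′ , r′+s′<q)) →
      <-irrefl refl (<-trans (+-mono-< (L<U a Lr Ur′) (L<U b Ls Us′)) (<-trans r′+s′<q q<r+s))
  ; located = located+
  }
  where
  L+ U+ : ℚ → Set
  L+ q = ∃₂ λ r s → L a r × L b s × q < r + s
  U+ q = ∃₂ λ r s → U a r × U b s × r + s < q

  raise : L a r → L b s → L+ (r + s)
  raise {s = s} Lr Ls = let (r′ , r<r′ , Lr′) = L-round a Lr in r′ , s , Lr′ , Ls , +-monoˡ-< s r<r′

  lower : U a r → U b s → U+ (r + s)
  lower {s = s} Ur Us = let (r′ , r′<r , Ur′) = U-round a Ur in r′ , s , Ur′ , Us , +-monoˡ-< s r′<r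

  located+ : ∀ q r → q < r → L+ q ⊎ U+ r
  located+ q r q<r = split (approximate a 0<h) (approximate b 0<h)
    where
    h : ℚ
    h = (r - q) * ½
    0<h : 0ℚ < h
    0<h = half-pos (p<q⇒0<q-p q<r)
    regroup : ∀ u u′ h → (u + h) + (u′ + h) ≡ (u + u′) + (h + h)
    regroup = solve-∀ ℚ-ring
    cancel : ∀ q r → q + (r - q) ≡ r
    cancel = solve-∀ ℚ-ring
    split : (∃₂ λ u v → L a u × U a v × v < u + h) → (∃₂ λ u v → L b u × U b v × v < u + h) →
            L+ q ⊎ U+ r
    split (u , v , Lu , Uv , v<u+h) (u′ , v′ , Lu′ , Uv′ , v′<u′+h) with q <? u + u′
    ... | yes q<u+u′ = inj₁ (u , u′ , Lu , Lu′ , q<u+u′)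
    ... | no q≮u+u′ = inj₂ (v , v′ , Uv , Uv′ , (begin-strict
      v + v′                 <⟨ +-mono-< v<u+h v′<u′+h ⟩
      (u + h) + (u′ + h)     ≡⟨ regroup u u′ h ⟩
      (u + u′) + (h + h)     ≡⟨ cong (u + u′ +_) (half+half (r - q)) ⟩
      (u + u′) + (r - q)     ≤⟨ +-monoˡ-≤ (r - q) (≮⇒≥ q≮u+u′) ⟩
      q + (r - q)            ≡⟨ cancel q r ⟩
      r                      ∎))

_-ℝ_ : ℝ → ℝ → ℝ
a -ℝ b = a +ℝ (-ℝ b)

_⊔ℝ_ : ℝ → ℝ → ℝ
a ⊔ℝ b = record
  { L = λ q → L a q ⊎ L b q
  ; U = λ q → U a q × U b q
  ; inhabitedL = let (q , Lq) = inhabitedL a in q , inj₁ Lq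
  ; inhabitedU = let (r , Ur) = inhabitedU a ; (s , Us) = inhabitedU b in r ⊔ s , common-upper Ur Us
  ; roundedL = λ q → [ (λ Laq → let (r , q<r , Lr) = L-round a Laq in r , q<r , inj₁ Lr)
                     , (λ Lbq → let (r , q<r , Lr) = L-round b Lbq in r , q<r , inj₂ Lr) ]′
                   , (λ (r , q<r , Lr) → [ (λ Lar → inj₁ (L-down a Lar q<r)) , (λ Lbr → inj₂ (L-down b Lbr q<r)) ]′ Lr)
  ; roundedU = λ q → (λ (Uaq , Ubq) → let (r , r<q , Ur) = U-round a Uaq ; (s , s<q , Us) = U-round b Ubq
                                       in r ⊔ s , ⊔-< r<q s<q , common-upper Ur Us)
                   , (λ (r , r<q , Uar , Ubr) → U-up a Uar r<q , U-up b Ubr r<q)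
  ; disjoint = λ q → λ { (inj₁ Laq , Uaq , _) → disjoint a q (Laq , Uaq)
                       ; (inj₂ Lbq , _ , Ubq) → disjoint b q (Lbq , Ubq) }
  ; located = located⊔
  }
  where
  common-upper : U a r → U b s → U a (r ⊔ s) × U b (r ⊔ s)
  common-upper {r} {s} Ur Us = U-up-≤ a Ur (p≤p⊔q r s) , U-up-≤ b Us (p≤q⊔p r s)

  ⊔-< : r < q → s < q → r ⊔ s < q
  ⊔-< {r} {q} {s} r<q s<q = [ (λ eq → subst (_< q) (sym eq) r<q) , (λ eq → subst (_< q) (sym eq) s<q) ]′ (⊔-sel r s)

  located⊔ : ∀ q r → q < r → (L a q ⊎ L b q) ⊎ (U a r × U b r)
  located⊔ q r q<r with located a q r q<r | located b q r q<r
  ... | inj₁ Laq | _        = inj₁ (inj₁ Laq)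
  ... | inj₂ _   | inj₁ Lbq = inj₁ (inj₂ Lbq)
  ... | inj₂ Uar | inj₂ Ubr = inj₂ (Uar , Ubr)

≃-sym : ∀ a b → a ≃ b → b ≃ a
≃-sym _ _ (L≃ , U≃) = (λ q → ×-swap (L≃ q)) , (λ q → ×-swap (U≃ q))

≃⇒≮ : ∀ a b → a ≃ b → ¬ (a <ℝ b)
≃⇒≮ a _ (L≃ , _) (q , Uaq , Lbq) = disjoint a q (proj₂ (L≃ q) Lbq , Uaq)

≮⇒L⊆L : ∀ a b → ¬ (b <ℝ a) → L a q → L b q
≮⇒L⊆L {q} a b b≮a Laq =
  let (r , q<r , Lar) = L-round a Laq
  in [ id , (λ Ubr → ⊥-elim (b≮a (r , Ubr , Lar))) ]′ (located b q r q<r)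

≮⇒U⊆U : ∀ a b → ¬ (a <ℝ b) → U a q → U b q
≮⇒U⊆U {q} a b a≮b Uaq =
  let (r , r<q , Uar) = U-round a Uaq
  in [ (λ Lbr → ⊥-elim (a≮b (r , Uar , Lbr))) , id ]′ (located b r q r<q)

≮∧≯⇒≃ : ∀ a b → ¬ (a <ℝ b) → ¬ (b <ℝ a) → a ≃ b
≮∧≯⇒≃ a b a≮b b≮a = (λ _ → ≮⇒L⊆L a b b≮a , ≮⇒L⊆L b a a≮b) , (λ _ → ≮⇒U⊆U a b a≮b , ≮⇒U⊆U b a b≮a)

<⇒<⊔ : ∀ a b → a <ℝ b → a <ℝ a ⊔ℝ b
<⇒<⊔ _ _ (q , Uaq , Lbq) = q , Uaq , inj₂ Lbq

≮⇒⊔≃ : ∀ a b → ¬ (a <ℝ b) → a ⊔ℝ b ≃ a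
≮⇒⊔≃ a b a≮b = ≮∧≯⇒≃ (a ⊔ℝ b) a
  (λ (q , (Uaq , _) , Laq) → disjoint a q (Laq , Uaq))
  (λ (q , Uaq , L⊔q) → [ (λ Laq → disjoint a q (Laq , Uaq)) , (λ Lbq → a≮b (q , Uaq , Lbq)) ]′ L⊔q)

<⇒0<- : ∀ a b → a <ℝ b → ιᶜ 0ℚ <ᶜ cut (b -ℝ a)
<⇒0<- a b (q , Uaq , Lbq) =
  let (r , q<r , Lbr) = L-round b Lbq
      (t , 0<t , t<r-q) = <-dense (p<q⇒0<q-p q<r)
  in t , 0<t , r , - q , Lbr , subst (U a) (sym (neg-involutive q)) Uaq , t<r-q

0<-⇒< : ∀ a b → ιᶜ 0ℚ <ᶜ cut (b -ℝ a) → a <ℝ b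
0<-⇒< _ b (t , 0<t , r , s , Lbr , Ua-s , t<r+s) =
  - s , Ua-s , L-down b Lbr (0<p+q⇒-q<p (<-trans 0<t t<r+s))

0<⇒<+ : ∀ a c → ιᶜ 0ℚ <ᶜ cut c → a <ℝ a +ℝ c
0<⇒<+ a c (t , 0<t , Lct) = witness (approximate a 0<t)
  where
  witness : (∃₂ λ u v → L a u × U a v × v < u + t) → a <ℝ a +ℝ c
  witness (u , v , Lu , Uv , v<u+t) = v , Uv , u , t , Lu , Lct , v<u+t

<+⇒0< : ∀ a c → a <ℝ a +ℝ c → ιᶜ 0ℚ <ᶜ cut c
<+⇒0< a _ (q , Uaq , r , s , Lar , Lcs , q<r+s) = s , p<p+q⇒0<q (<-trans (L<U a Lar Uaq) q<r+s) , Lcs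

≮⊎≄⇒<-weaklyDecidable : ∀ x → (∀ y → ¬ (x <ℝ y) ⊎ y ≄ x) → ∀ a b → ¬ (a <ℝ b) ⊎ ¬ ¬ (a <ℝ b)
≮⊎≄⇒<-weaklyDecidable x x≮⊎≄ a b =
  [ (λ x≮x⊔z → inj₁ λ a<b → x≮x⊔z (<⇒<⊔ x z (0<⇒<+ x (b -ℝ a) (<⇒0<- a b a<b))))
  , (λ x⊔z≄x → inj₂ λ a≮b → x⊔z≄x (≮⇒⊔≃ x z λ x<z → a≮b (0<-⇒< a b (<+⇒0< x (b -ℝ a) x<z))))
  ]′ (x≮⊎≄ (x ⊔ℝ z))
  where
  z : ℝ
  z = x +ℝ (b -ℝ a)

<-weaklyDecidable⇒≃-decidable : (∀ a b → ¬ (a <ℝ b) ⊎ ¬ ¬ (a <ℝ b)) → ∀ a b → a ≃ b ⊎ a ≄ b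
<-weaklyDecidable⇒≃-decidable <-wd a b with <-wd a b | <-wd b a
... | inj₂ ¬a≮b | _         = inj₂ (¬a≮b ∘ ≃⇒≮ a b)
... | _         | inj₂ ¬b≮a = inj₂ (¬b≮a ∘ ≃⇒≮ b a ∘ ≃-sym a b)
... | inj₁ a≮b  | inj₁ b≮a  = inj₁ (≮∧≯⇒≃ a b a≮b b≮a)

_<ℝ_+ℚ_ : ℝ → ℝ → ℚ → Set
a <ℝ b +ℚ e = ∃₂ λ α β → U a α × L b β × α < β + e

_+ℚ_<ℝ_ : ℝ → ℚ → ℝ → Set
a +ℚ e <ℝ b = ∃₂ λ α β → U a α × L b β × α + e < β

+ℚ<ℝ⇒≮ℝ+ℚ : ∀ a b → a +ℚ q <ℝ b → ¬ (b <ℝ a +ℚ q)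
+ℚ<ℝ⇒≮ℝ+ℚ {e} a b (α , β , Uaα , Lbβ , α+e<β) (γ , δ , Ubγ , Laδ , γ<δ+e) =
  <-irrefl refl (begin-strict
    α + e     <⟨ α+e<β ⟩
    β         <⟨ L<U b Lbβ Ubγ ⟩
    γ         <⟨ γ<δ+e ⟩
    δ + e     <⟨ +-monoˡ-< e (L<U a Laδ Uaα) ⟩
    α + e     ∎)

ε<∣a-b∣⇒separated : ∀ ε a b → L ε q → cut ε <ᶜ ∣ cut a -ᶜ cut b ∣ᶜ → (b +ℚ q <ℝ a) ⊎ (a +ℚ q <ℝ b)
ε<∣a-b∣⇒separated ε _ _ Lεe (s , Uεs , inj₁ (r , t , Lar , Ubt , s<r-t)) =
  inj₁ (t , r , Ubt , Lar , p<q-r⇒r+p<q {q = r} (<-trans (L<U ε Lεe Uεs) s<r-t))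
ε<∣a-b∣⇒separated ε _ _ Lεe (s , Uεs , inj₂ (r , t , Uar , Lbt , r-t<-s)) =
  inj₂ (r , t , Uar , Lbt , p-q<-r⇒p+r<q {p = r} {q = t} (<-trans r-t<-s (neg-antimono-< (L<U ε Lεe Uεs))))

within⊎apart : 0ℚ < q → ∀ a c → ((c <ℝ a +ℚ q) × (a <ℝ c +ℚ q)) ⊎ (a <ℝ c ⊎ c <ℝ a)
within⊎apart {e} 0<e a c = compare (approximate a 0<h)
  where
  h : ℚ
  h = e * ½
  0<h : 0ℚ < h
  0<h = half-pos 0<e
  regroup : ∀ p h → p + h ≡ p - h + (h + h)
  regroup = solve-∀ ℚ-ring
  compare : (∃₂ λ u v → L a u × U a v × v < u + h) → ((c <ℝ a +ℚ e) × (a <ℝ c +ℚ e)) ⊎ (a <ℝ c ⊎ c <ℝ a)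
  compare (p , p′ , Lap , Uap′ , p′<p+h) =
    [ (λ Lc[p-h] → [ (λ Lcp′ → inj₂ (inj₁ (p′ , Uap′ , Lcp′)))
                   , (λ Uc[p′+h] → inj₁ ((p′ + h , p , Uc[p′+h] , Lap , upper) , (p′ , p - h , Uap′ , Lc[p-h] , lower)))
                   ]′ (located c p′ (p′ + h) (p<p+q 0<h)))
    , (λ Ucp → inj₂ (inj₂ (p , Ucp , Lap)))
    ]′ (located c (p - h) p (p-q<p 0<h))
    where
    upper : p′ + h < p + e
    upper = begin-strict
      p′ + h          <⟨ +-monoˡ-< h p′<p+h ⟩
      p + h + h       ≡⟨ +-assoc p h h ⟩
      p + (h + h)     ≡⟨ cong (p +_) (half+half e) ⟩
      p + e           ∎
    lower : p′ < p - h + e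
    lower = begin-strict
      p′              <⟨ p′<p+h ⟩
      p + h           ≡⟨ regroup p h ⟩
      p - h + (h + h) ≡⟨ cong (p - h +_) (half+half e) ⟩
      p - h + e       ∎

jump⇒≮⊎≄ : ∀ f → Extensional f → ∀ x → JumpsAt f x → ∀ y → ¬ (x <ℝ y) ⊎ y ≄ x
jump⇒≮⊎≄ f f-ext x (ε , (e , 0<e , Lεe) , jump) y =
  [ (λ (fy<fx+e , fx<fy+e) → inj₁ λ x<y →
      [ (λ fx+e<fy → +ℚ<ℝ⇒≮ℝ+ℚ (f x) (f y) fx+e<fy fy<fx+e)
      , (λ fy+e<fx → +ℚ<ℝ⇒≮ℝ+ℚ (f y) (f x) fy+e<fx fx<fy+e)
      ]′ (ε<∣a-b∣⇒separated ε (f y) (f x) Lεe (jump y x<y)))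
  , (λ fx#fy → inj₂ λ y≃x → let fy≃fx = f-ext y x y≃x in
      [ ≃⇒≮ (f x) (f y) (≃-sym (f y) (f x) fy≃fx) , ≃⇒≮ (f y) (f x) fy≃fx ]′ fx#fy)
  ]′ (within⊎apart 0<e (f x) (f y))

proposition7p5 : (Σ (ℝ → ℝ) λ f → Extensional f × Σ ℝ λ x → JumpsAt f x)
    → ∀ (x y : ℝ) → (x ≃ y) ⊎ (x ≄ y)
proposition7p5 (f , f-ext , x , jump) =
  <-weaklyDecidable⇒≃-decidable (≮⊎≄⇒<-weaklyDecidable x (jump⇒≮⊎≄ f f-ext x jump))
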